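{- Let $n\ge s\ge 1$ and $\ell\ge 1$ be integers. For a positive integer $\ell'$, let $\mathrm{CAN}(n,\ell';s)$ be the set of matrices in $O_{n,\ell'}(\mathbb{Q})$ of the block diagonal form $\operatorname{diag}(Q_s, I_{n-s})$, where $Q_s$ is an $s\times s$ rational orthogonal matrix whose entries are zero or non-integers. Then $$\sum_{\ell'\mid \ell}\bigl|\mathrm{CAN}(n,\ell';s)\bigr| \le (2s)^{\ell^2 s}.$$
   Context: The level of a rational matrix $M$ is the smallest positive integer $\ell$ such that $\ell M$ is an integer matrix; $O_{n,\ell}(\mathbb{Q})$ is the set of $n\times n$ rational orthogonal matrices of level $\ell$. The sum runs over positive divisors $\ell'$ of $\ell$. -}

module Defs where

open import Data.Nat as ℕ using (ℕ; zero; suc; _≤_; _<_)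
open import Data.Nat.Divisibility using (_∣?_)
open import Data.Integer using (+_)
open import Data.Rational as ℚ using (ℚ; 0ℚ; 1ℚ; _+_; _*_; _/_)
open import Data.Fin using (Fin)
open import Data.Vec as Vec using (Vec; []; _∷_; _++_; replicate; map; zipWith; foldr; tabulate; transpose)
open import Data.Vec.Relation.Unary.All as VAll using ()
open import Data.List as List using (List; upTo; filter)
open import Data.Nat.ListAction using (sum)
open import Data.Product using (Σ; _×_)
open import Data.Sum using (_⊎_)
open import Relation.Binary.PropositionalEquality using (_≡_)
open import Relation.Nullary using (¬_)
open import Data.Fin.Properties using (_≟_)
open import Relation.Nullary.Decidable using (does)
open import Data.Bool using (if_then_else_)

-- n × n rational matrices, as vectors of rows.
Matrix : ℕ → Set
Matrix n = Vec (Vec ℚ n) n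

dot : ∀ {n} → Vec ℚ n → Vec ℚ n → ℚ
dot u v = foldr (λ _ → ℚ) _+_ 0ℚ (zipWith _*_ u v)

_⊗_ : ∀ {n} → Matrix n → Matrix n → Matrix n
A ⊗ B = map (λ r → map (λ c → dot r c) (transpose B)) A

identity : (n : ℕ) → Matrix n
identity n = tabulate (λ i → tabulate (λ j → if does (i ≟ j) then 1ℚ else 0ℚ))

Orthogonal : ∀ {n} → Matrix n → Set
Orthogonal {n} M = transpose M ⊗ M ≡ identity n

-- a rational number is an integer iff its (normalised) denominator is 1.
IsInt : ℚ → Set
IsInt q = ℚ.denominatorℕ q ≡ 1

scale : ∀ {n} → ℕ → Matrix n → Matrix n
scale k M = map (map (λ x → (+ k / 1) * x)) M

AllEntries : ∀ {n} → (ℚ → Set) → Matrix n → Set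
AllEntries P M = VAll.All (VAll.All P) M

IntegerMatrix : ∀ {n} → Matrix n → Set
IntegerMatrix M = AllEntries IsInt M

HasLevel : ∀ {n} → ℕ → Matrix n → Set
HasLevel ℓ M = (1 ≤ ℓ) × IntegerMatrix (scale ℓ M)
             × (∀ k → 1 ≤ k → k < ℓ → ¬ IntegerMatrix (scale k M))

InO : ∀ {n} → ℕ → Matrix n → Set
InO ℓ M = Orthogonal M × HasLevel ℓ M

blockDiag : ∀ {s t} → Matrix s → Matrix t → Matrix (s ℕ.+ t)
blockDiag {s} {t} Q P =
  map (λ r → r ++ replicate t 0ℚ) Q ++ map (λ r → replicate s 0ℚ ++ r) P

ZeroOrNonInt : ℚ → Set
ZeroOrNonInt q = (q ≡ 0ℚ) ⊎ ¬ IsInt q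

-- CAN(n, ℓ'; s) with n = s + t.
CAN : (s t ℓ' : ℕ) → Matrix (s ℕ.+ t) → Set
CAN s t ℓ' M = InO ℓ' M ×
  Σ (Matrix s) (λ Q → Orthogonal Q × AllEntries ZeroOrNonInt Q × (M ≡ blockDiag Q (identity t)))

divisors : ℕ → List ℕ
divisors ℓ = filter (_∣? ℓ) (List.map suc (upTo ℓ))

sumDiv : ℕ → (ℕ → ℕ) → ℕ
sumDiv ℓ f = sum (List.map f (divisors ℓ))

-- If M = diag(Q, I) has level d ∣ ℓ, then ℓQ is an integer matrix, so every column of Q is
-- z/ℓ for an integer vector z with |z|² = ℓ². Such a z is the sum of a word of length exactly
-- ℓ² in the 2s letters ±eⱼ: take |zⱼ| copies of sign(zⱼ)eⱼ and pad with cancelling pairs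
-- eⱼ, -eⱼ up to zⱼ² letters. Hence M is determined by s words of length ℓ², one of
-- (2s)^(ℓ²s) codes. The level of a matrix is unique, so the lists for different divisors are
-- disjoint, and the bound is a pigeonhole count. The condition on the entries of Q is not needed.
module Submission where

open import Defs
open import Data.Nat using (ℕ; NonZero)

module Enumeration where

  open import Data.Nat using (ℕ; zero; suc; _≤_; _+_; _*_; _^_)
  open import Data.Nat.ListAction using (sum)
  open import Data.Fin using (Fin; zero; suc)
  open import Data.Fin.Properties using (injective⇒≤)
  open import Data.Product using (_×_; _,_)
  open import Data.List as List
    using (List; []; _∷_; _++_; length; lookup; concatMap; cartesianProductWith)
  import Data.List.Properties as List
  open import Data.List.Membership.Propositional using (_∈_)
  open import Data.List.Membership.Propositional.Properties
    using (∈-lookup; ∈-cartesianProductWith⁺; ∈-concatMap⁻)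
  open import Data.List.Relation.Unary.Any using (here; index)
  open import Data.List.Relation.Unary.Any.Properties using (lookup-index)
  open import Data.List.Relation.Unary.All as All using (All; []; _∷_)
  open import Data.List.Relation.Unary.AllPairs using ([]; _∷_)
  open import Data.List.Relation.Unary.Unique.Propositional using (Unique)
  import Data.List.Relation.Unary.Unique.Propositional.Properties as Unique
  open import Data.List.Relation.Binary.Disjoint.Propositional using (Disjoint)
  open import Data.Vec using (Vec; []; _∷_)
  open import Function using (_∘_)
  open import Relation.Binary.PropositionalEquality
  open import Relation.Nullary using (contradiction)
  open ≡-Reasoning

  module _ {a} {A : Set a} where

    Unique⇒lookup-injective : ∀ {xs : List A} → Unique xs →
                              ∀ {i j} → lookup xs i ≡ lookup xs j → i ≡ j
    Unique⇒lookup-injective (_   ∷ _) {zero}  {zero}  _  = refl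
    Unique⇒lookup-injective (x∉ ∷ _) {zero}  {suc j} eq = contradiction eq (All.lookup x∉ (∈-lookup j))
    Unique⇒lookup-injective (x∉ ∷ _) {suc i} {zero}  eq = contradiction (sym eq) (All.lookup x∉ (∈-lookup i))
    Unique⇒lookup-injective (_  ∷ u) {suc i} {suc j} eq = cong suc (Unique⇒lookup-injective u eq)

    Unique-⊆⇒length≤ : ∀ {xs ys : List A} → Unique xs → All (_∈ ys) xs → length xs ≤ length ys
    Unique-⊆⇒length≤ {xs} {ys} u xs⊆ys = injective⇒≤ position-injective
      where
      position : Fin (length xs) → Fin (length ys)
      position i = index (All.lookup xs⊆ys (∈-lookup i))

      position-injective : ∀ {i j} → position i ≡ position j → i ≡ j
      position-injective {i} {j} eq = Unique⇒lookup-injective u (begin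
        lookup xs i             ≡⟨ lookup-index (All.lookup xs⊆ys (∈-lookup i)) ⟩
        lookup ys (position i)  ≡⟨ cong (lookup ys) eq ⟩
        lookup ys (position j)  ≡⟨ lookup-index (All.lookup xs⊆ys (∈-lookup j)) ⟨
        lookup xs j             ∎)

  module _ {a b c} {A : Set a} {B : Set b} {C : Set c} (f : A → B → C) where

    length-cartesianProductWith : ∀ xs ys →
      length (cartesianProductWith f xs ys) ≡ length xs * length ys
    length-cartesianProductWith []       ys = refl
    length-cartesianProductWith (x ∷ xs) ys = begin
      length (List.map (f x) ys ++ cartesianProductWith f xs ys)
        ≡⟨ List.length-++ (List.map (f x) ys) ⟩
      length (List.map (f x) ys) + length (cartesianProductWith f xs ys)
        ≡⟨ cong₂ _+_ (List.length-map (f x) ys) (length-cartesianProductWith xs ys) ⟩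
      length ys + length xs * length ys
        ∎

  module _ {a} {A : Set a} where

    allVecs : List A → (k : ℕ) → List (Vec A k)
    allVecs xs zero    = [] ∷ []
    allVecs xs (suc k) = cartesianProductWith _∷_ xs (allVecs xs k)

    length-allVecs : ∀ xs k → length (allVecs xs k) ≡ length xs ^ k
    length-allVecs xs zero    = refl
    length-allVecs xs (suc k) = trans (length-cartesianProductWith _∷_ xs (allVecs xs k))
                                      (cong (length xs *_) (length-allVecs xs k))

    ∈-allVecs : ∀ {xs} → (∀ x → x ∈ xs) → ∀ {k} (v : Vec A k) → v ∈ allVecs xs k
    ∈-allVecs ∈xs []      = here refl
    ∈-allVecs ∈xs (x ∷ v) = ∈-cartesianProductWith⁺ _∷_ (∈xs x) (∈-allVecs ∈xs v)

  module _ {a b} {K : Set a} {A : Set b} (f : K → List A) where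

    length-concatMap : ∀ ks → length (concatMap f ks) ≡ sum (List.map (length ∘ f) ks)
    length-concatMap []       = refl
    length-concatMap (k ∷ ks) = trans (List.length-++ (f k)) (cong (length (f k) +_) (length-concatMap ks))

    module _ {p} (P : K → A → Set p) (P-functional : ∀ {k k′ x} → P k x → P k′ x → k ≡ k′) where

      Unique-concatMap : ∀ {ks} → Unique ks → All (λ k → Unique (f k) × All (P k) (f k)) ks →
                         Unique (concatMap f ks)
      Unique-concatMap {[]}     []          []                 = []
      Unique-concatMap {k ∷ ks} (k∉ks ∷ u) ((uk , Pk) ∷ Pks) =
        Unique.++⁺ uk (Unique-concatMap u Pks) disjoint
        where
        disjoint : Disjoint (f k) (concatMap f ks)
        disjoint (x∈fk , x∈rest)
          with (k≢k′ , _ , Pk′) , x∈fk′ ← All.lookupAny (All.zip (k∉ks , Pks)) (∈-concatMap⁻ f {xs = ks} x∈rest)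
          = k≢k′ (P-functional (All.lookup Pk x∈fk) (All.lookup Pk′ x∈fk′))

module Words where

  open import Data.Nat as ℕ using (ℕ; zero; suc)
  import Data.Nat.Properties as ℕ
  open import Data.Nat.Solver using (module +-*-Solver)
  open import Data.Integer using (ℤ; +_; -[1+_]; 0ℤ; _◃_; sign; ∣_∣; _+_)
  import Data.Integer.Properties as ℤ
  open import Data.Sign as Sign using (Sign)
  open import Data.Fin using (Fin; zero; suc)
  open import Data.Fin.Properties using (_≟_)
  open import Data.Bool using (true; false; if_then_else_)
  open import Relation.Nullary.Decidable using (does)
  open import Data.Product using (_×_; _,_; map₂)
  open import Data.List as List using (List; []; _∷_; _++_; length; cartesianProduct; allFin)
  import Data.List.Properties as List
  open import Data.List.Membership.Propositional using (_∈_)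
  open import Data.List.Membership.Propositional.Properties using (∈-cartesianProduct⁺; ∈-allFin)
  open import Data.List.Relation.Unary.Any using (here; there)
  open import Data.Vec using (Vec; []; _∷_; lookup)
  open import Relation.Binary.PropositionalEquality
  open ≡-Reasoning
  open Enumeration using (length-cartesianProductWith)

  δ : ∀ {s} → Fin s → Fin s → ℤ → ℤ
  δ i j z = if does (i ≟ j) then z else 0ℤ

  δ-+ : ∀ {s} (i j : Fin s) a b → δ i j (a + b) ≡ δ i j a + δ i j b
  δ-+ i j a b with does (i ≟ j)
  ... | true  = refl
  ... | false = refl

  δ-0 : ∀ {s} (i j : Fin s) → δ i j 0ℤ ≡ 0ℤ
  δ-0 i j with does (i ≟ j)
  ... | true  = refl
  ... | false = refl

  -- (σ , i) stands for the signed unit vector σ eᵢ of ℤˢ.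
  Letter : ℕ → Set
  Letter s = Sign × Fin s

  signs : List Sign
  signs = Sign.+ ∷ Sign.- ∷ []

  letters : (s : ℕ) → List (Letter s)
  letters s = cartesianProduct signs (allFin s)

  length-letters : ∀ s → length (letters s) ≡ 2 ℕ.* s
  length-letters s = trans (length-cartesianProductWith _,_ signs (allFin s))
                           (cong (2 ℕ.*_) (List.length-tabulate {n = s} (λ i → i)))

  ∈-letters : ∀ {s} (x : Letter s) → x ∈ letters s
  ∈-letters (Sign.+ , i) = ∈-cartesianProduct⁺ {xs = signs} (here refl) (∈-allFin i)
  ∈-letters (Sign.- , i) = ∈-cartesianProduct⁺ {xs = signs} (there (here refl)) (∈-allFin i)

  net : ∀ {s} → List (Letter s) → Fin s → ℤ
  net []            j = 0ℤ
  net ((σ , i) ∷ w) j = δ i j (σ ◃ 1) + net w j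

  net-++ : ∀ {s} (u v : List (Letter s)) j → net (u ++ v) j ≡ net u j + net v j
  net-++ []            v j = sym (ℤ.+-identityˡ (net v j))
  net-++ ((σ , i) ∷ u) v j = begin
    δ i j (σ ◃ 1) + net (u ++ v) j         ≡⟨ cong (_+_ (δ i j (σ ◃ 1))) (net-++ u v j) ⟩
    δ i j (σ ◃ 1) + (net u j + net v j)    ≡⟨ ℤ.+-assoc (δ i j (σ ◃ 1)) (net u j) (net v j) ⟨
    δ i j (σ ◃ 1) + net u j + net v j      ∎

  cancellingPairs : ∀ {s} → Fin s → ℕ → List (Letter s)
  cancellingPairs i zero    = []
  cancellingPairs i (suc n) = (Sign.+ , i) ∷ (Sign.- , i) ∷ cancellingPairs i n

  net-cancellingPairs : ∀ {s} (i : Fin s) n j → net (cancellingPairs i n) j ≡ 0ℤ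
  net-cancellingPairs i zero    j = refl
  net-cancellingPairs i (suc n) j = begin
    δ i j (+ 1) + (δ i j -[1+ 0 ] + net (cancellingPairs i n) j)
      ≡⟨ cong (λ x → δ i j (+ 1) + (δ i j -[1+ 0 ] + x)) (net-cancellingPairs i n j) ⟩
    δ i j (+ 1) + (δ i j -[1+ 0 ] + 0ℤ)   ≡⟨ cong (_+_ (δ i j (+ 1))) (ℤ.+-identityʳ _) ⟩
    δ i j (+ 1) + δ i j -[1+ 0 ]          ≡⟨ δ-+ i j (+ 1) -[1+ 0 ] ⟨
    δ i j 0ℤ                              ≡⟨ δ-0 i j ⟩
    0ℤ                                    ∎

  length-cancellingPairs : ∀ {s} (i : Fin s) n → length (cancellingPairs i n) ≡ n ℕ.+ n
  length-cancellingPairs i zero    = refl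
  length-cancellingPairs i (suc n) =
    cong suc (trans (cong suc (length-cancellingPairs i n)) (sym (ℕ.+-suc n n)))

  -- n copies of (σ , i) and n(n-1)/2 cancelling pairs: a word of length n² with sum σ n eᵢ.
  squareWord : ∀ {s} → Sign → Fin s → ℕ → List (Letter s)
  squareWord σ i zero    = []
  squareWord σ i (suc n) = (σ , i) ∷ squareWord σ i n ++ cancellingPairs i n

  net-squareWord : ∀ {s} σ (i : Fin s) n j → net (squareWord σ i n) j ≡ δ i j (σ ◃ n)
  net-squareWord σ i zero    j = sym (δ-0 i j)
  net-squareWord σ i (suc n) j = begin
    δ i j (σ ◃ 1) + net (squareWord σ i n ++ cancellingPairs i n) j
      ≡⟨ cong (_+_ (δ i j (σ ◃ 1))) (net-++ (squareWord σ i n) (cancellingPairs i n) j) ⟩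
    δ i j (σ ◃ 1) + (net (squareWord σ i n) j + net (cancellingPairs i n) j)
      ≡⟨ cong₂ (λ x y → δ i j (σ ◃ 1) + (x + y)) (net-squareWord σ i n j) (net-cancellingPairs i n j) ⟩
    δ i j (σ ◃ 1) + (δ i j (σ ◃ n) + 0ℤ)
      ≡⟨ cong (_+_ (δ i j (σ ◃ 1))) (ℤ.+-identityʳ _) ⟩
    δ i j (σ ◃ 1) + δ i j (σ ◃ n)
      ≡⟨ δ-+ i j (σ ◃ 1) (σ ◃ n) ⟨
    δ i j ((σ ◃ 1) + (σ ◃ n))
      ≡⟨ cong (δ i j) (ℤ.◃-distrib-+ σ 1 n) ⟨
    δ i j (σ ◃ suc n)
      ∎

  length-squareWord : ∀ {s} σ (i : Fin s) n → length (squareWord σ i n) ≡ n ℕ.* n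
  length-squareWord σ i zero    = refl
  length-squareWord σ i (suc n) = cong suc (begin
    length (squareWord σ i n ++ cancellingPairs i n)
      ≡⟨ List.length-++ (squareWord σ i n) ⟩
    length (squareWord σ i n) ℕ.+ length (cancellingPairs i n)
      ≡⟨ cong₂ ℕ._+_ (length-squareWord σ i n) (length-cancellingPairs i n) ⟩
    n ℕ.* n ℕ.+ (n ℕ.+ n)
      ≡⟨ solve 1 (λ n → n :* n :+ (n :+ n) := n :+ n :* (con 1 :+ n)) refl n ⟩
    n ℕ.+ n ℕ.* suc n
      ∎)
    where open +-*-Solver

  wordℤ : ∀ {s} → Fin s → ℤ → List (Letter s)
  wordℤ i z = squareWord (sign z) i ∣ z ∣

  net-wordℤ : ∀ {s} (i : Fin s) z j → net (wordℤ i z) j ≡ δ i j z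
  net-wordℤ i z j = trans (net-squareWord (sign z) i ∣ z ∣ j) (cong (δ i j) (ℤ.◃-inverse z))

  normSq : ∀ {s} → Vec ℤ s → ℕ
  normSq []       = 0
  normSq (z ∷ zs) = ∣ z ∣ ℕ.* ∣ z ∣ ℕ.+ normSq zs

  shift : ∀ {s} → Letter s → Letter (suc s)
  shift = map₂ suc

  net-shift-zero : ∀ {s} (w : List (Letter s)) → net (List.map shift w) zero ≡ 0ℤ
  net-shift-zero []      = refl
  net-shift-zero (_ ∷ w) = trans (ℤ.+-identityˡ _) (net-shift-zero w)

  net-shift-suc : ∀ {s} (w : List (Letter s)) j → net (List.map shift w) (suc j) ≡ net w j
  net-shift-suc []            j = refl
  net-shift-suc ((σ , i) ∷ w) j = cong (_+_ (δ i j (σ ◃ 1))) (net-shift-suc w j)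

  wordVec : ∀ {s} → Vec ℤ s → List (Letter s)
  wordVec []       = []
  wordVec (z ∷ zs) = wordℤ zero z ++ List.map shift (wordVec zs)

  net-wordVec : ∀ {s} (zs : Vec ℤ s) j → net (wordVec zs) j ≡ lookup zs j
  net-wordVec (z ∷ zs) j = trans (net-++ (wordℤ zero z) (List.map shift (wordVec zs)) j) (split j)
    where
    split : ∀ j → net (wordℤ zero z) j + net (List.map shift (wordVec zs)) j ≡ lookup (z ∷ zs) j
    split zero    = trans (cong₂ _+_ (net-wordℤ zero z zero) (net-shift-zero (wordVec zs)))
                          (ℤ.+-identityʳ z)
    split (suc j) = trans (cong₂ _+_ (net-wordℤ zero z (suc j)) (net-shift-suc (wordVec zs) j))
                          (trans (ℤ.+-identityˡ _) (net-wordVec zs j))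

  length-wordVec : ∀ {s} (zs : Vec ℤ s) → length (wordVec zs) ≡ normSq zs
  length-wordVec []       = refl
  length-wordVec (z ∷ zs) = begin
    length (wordℤ zero z ++ List.map shift (wordVec zs))
      ≡⟨ List.length-++ (wordℤ zero z) ⟩
    length (wordℤ zero z) ℕ.+ length (List.map shift (wordVec zs))
      ≡⟨ cong₂ ℕ._+_ (length-squareWord (sign z) zero ∣ z ∣)
                     (trans (List.length-map shift (wordVec zs)) (length-wordVec zs)) ⟩
    normSq (z ∷ zs)
      ∎

module IntegerRationals where

  open import Data.Nat as ℕ using (zero)
  open import Data.Nat.Coprimality using (1-coprimeTo)
  import Data.Nat.Coprimality as Coprime
  open import Data.Nat.Divisibility using (_∣_; divides)
  open import Data.Integer as ℤ using (ℤ; +_; -[1+_])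
  import Data.Integer.Properties as ℤ
  import Data.Integer.Solver as ℤ-Solver
  open import Data.Rational using (ℚ; mkℚ; _+_; _*_; _/_; ↥_; ↧ₙ_)
  import Data.Rational.Properties as ℚ
  open import Data.Rational.Solver using (module +-*-Solver)
  import Data.Rational.Unnormalised as ℚᵘ
  import Data.Rational.Unnormalised.Properties as ℚᵘ
  open import Data.Vec using (Vec; []; _∷_; map)
  open import Data.Vec.Relation.Unary.All using (All; []; _∷_)
  open import Relation.Binary.PropositionalEquality
  open ≡-Reasoning
  open Words using (normSq)

  fromℤ : ℤ → ℚ
  fromℤ z = mkℚ z 0 (Coprime.sym (1-coprimeTo _))

  z/1≡fromℤ : ∀ z → z / 1 ≡ fromℤ z
  z/1≡fromℤ z = ℚ.↥p/↧p≡p (fromℤ z)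

  fromℤ-injective : ∀ {a b} → fromℤ a ≡ fromℤ b → a ≡ b
  fromℤ-injective = cong ↥_

  fromℤ-+ : ∀ a b → fromℤ (a ℤ.+ b) ≡ fromℤ a + fromℤ b
  fromℤ-+ a b = ℚ.toℚᵘ-injective
    (ℚᵘ.≃-trans (ℚᵘ.*≡* cross) (ℚᵘ.≃-sym (ℚ.toℚᵘ-homo-+ (fromℤ a) (fromℤ b))))
    where
    open ℤ-Solver.+-*-Solver
    cross : (a ℤ.+ b) ℤ.* (+ 1 ℤ.* + 1) ≡ (a ℤ.* + 1 ℤ.+ b ℤ.* + 1) ℤ.* + 1
    cross = solve 2 (λ a b → (a :+ b) :* (con (+ 1) :* con (+ 1))
                          := (a :* con (+ 1) :+ b :* con (+ 1)) :* con (+ 1)) refl a b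

  fromℤ-* : ∀ a b → fromℤ (a ℤ.* b) ≡ fromℤ a * fromℤ b
  fromℤ-* a b = ℚ.toℚᵘ-injective
    (ℚᵘ.≃-trans (ℚᵘ.*≡* cross) (ℚᵘ.≃-sym (ℚ.toℚᵘ-homo-* (fromℤ a) (fromℤ b))))
    where
    open ℤ-Solver.+-*-Solver
    cross : (a ℤ.* b) ℤ.* (+ 1 ℤ.* + 1) ≡ (a ℤ.* b) ℤ.* + 1
    cross = solve 2 (λ a b → (a :* b) :* (con (+ 1) :* con (+ 1)) := (a :* b) :* con (+ 1)) refl a b

  isInt⇒≡fromℤ : ∀ q → IsInt q → q ≡ fromℤ (↥ q)
  isInt⇒≡fromℤ (mkℚ _ zero _) refl = refl

  map-fromℤ-↥ : ∀ {n} {v : Vec ℚ n} → All IsInt v → map fromℤ (map ↥_ v) ≡ v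
  map-fromℤ-↥ {v = []}    []             = refl
  map-fromℤ-↥ {v = x ∷ v} (x∈ℤ ∷ v∈ℤ) = cong₂ _∷_ (sym (isInt⇒≡fromℤ x x∈ℤ)) (map-fromℤ-↥ v∈ℤ)

  isInt-* : ∀ p q → IsInt p → IsInt q → IsInt (p * q)
  isInt-* p q p∈ℤ q∈ℤ = cong ↧ₙ_ (begin
    p * q                       ≡⟨ cong₂ _*_ (isInt⇒≡fromℤ p p∈ℤ) (isInt⇒≡fromℤ q q∈ℤ) ⟩
    fromℤ (↥ p) * fromℤ (↥ q)   ≡⟨ fromℤ-* (↥ p) (↥ q) ⟨
    fromℤ (↥ p ℤ.* ↥ q)         ∎)

  divides⇒isInt : ∀ {d ℓ} x → d ∣ ℓ → IsInt ((+ d / 1) * x) → IsInt (fromℤ (+ ℓ) * x)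
  divides⇒isInt {d} x (divides q refl) dx∈ℤ =
    subst IsInt (sym qd≡q*d) (isInt-* (fromℤ (+ q)) ((+ d / 1) * x) refl dx∈ℤ)
    where
    qd≡q*d : fromℤ (+ (q ℕ.* d)) * x ≡ fromℤ (+ q) * ((+ d / 1) * x)
    qd≡q*d = begin
      fromℤ (+ (q ℕ.* d)) * x          ≡⟨ cong (λ z → fromℤ z * x) (ℤ.pos-* q d) ⟩
      fromℤ (+ q ℤ.* + d) * x          ≡⟨ cong (_* x) (fromℤ-* (+ q) (+ d)) ⟩
      fromℤ (+ q) * fromℤ (+ d) * x    ≡⟨ ℚ.*-assoc (fromℤ (+ q)) (fromℤ (+ d)) x ⟩
      fromℤ (+ q) * (fromℤ (+ d) * x)  ≡⟨ cong (λ y → fromℤ (+ q) * (y * x)) (z/1≡fromℤ (+ d)) ⟨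
      fromℤ (+ q) * ((+ d / 1) * x)    ∎

  dot-scale : ∀ {n} a (u v : Vec ℚ n) → dot (map (a *_) u) (map (a *_) v) ≡ a * a * dot u v
  dot-scale a []      []      = sym (ℚ.*-zeroʳ (a * a))
  dot-scale a (x ∷ u) (y ∷ v) = begin
    a * x * (a * y) + dot (map (a *_) u) (map (a *_) v) ≡⟨ cong (_+_ (a * x * (a * y))) (dot-scale a u v) ⟩
    a * x * (a * y) + a * a * dot u v                   ≡⟨ solve 4 (λ a x y d → a :* x :* (a :* y) :+ a :* a :* d
                                                                        := a :* a :* (x :* y :+ d)) refl a x y (dot u v) ⟩
    a * a * (x * y + dot u v)                           ∎
    where open +-*-Solver

  fromℤ-normSq : ∀ {n} (z : Vec ℤ n) → fromℤ (+ normSq z) ≡ dot (map fromℤ z) (map fromℤ z)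
  fromℤ-normSq []       = refl
  fromℤ-normSq (z ∷ zs) = begin
    fromℤ (+ (∣z∣² ℕ.+ normSq zs))                      ≡⟨ cong fromℤ (ℤ.pos-+ ∣z∣² (normSq zs)) ⟩
    fromℤ (+ ∣z∣² ℤ.+ + normSq zs)                      ≡⟨ fromℤ-+ (+ ∣z∣²) (+ normSq zs) ⟩
    fromℤ (+ ∣z∣²) + fromℤ (+ normSq zs)                ≡⟨ cong₂ _+_ (cong fromℤ (∣z∣²≡z² z)) (fromℤ-normSq zs) ⟩
    fromℤ (z ℤ.* z) + dot (map fromℤ zs) (map fromℤ zs) ≡⟨ cong (_+ dot (map fromℤ zs) (map fromℤ zs)) (fromℤ-* z z) ⟩
    fromℤ z * fromℤ z + dot (map fromℤ zs) (map fromℤ zs) ∎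
    where
    ∣z∣² = ℤ.∣ z ∣ ℕ.* ℤ.∣ z ∣
    ∣z∣²≡z² : ∀ z → + (ℤ.∣ z ∣ ℕ.* ℤ.∣ z ∣) ≡ z ℤ.* z
    ∣z∣²≡z² (+ n)     = sym (ℤ.+◃n≡+n (n ℕ.* n))
    ∣z∣²≡z² -[1+ n ] = sym (ℤ.+◃n≡+n _)

module Matrices where

  import Data.Nat.Properties as ℕ
  open import Data.Integer using (+_)
  open import Data.Rational using (ℚ; 0ℚ; 1ℚ; _*_; _/_)
  open import Data.Fin using (Fin; _↑ˡ_)
  open import Data.Fin.Properties using (_≟_)
  open import Data.Bool using (if_then_else_)
  open import Relation.Nullary.Decidable using (Dec; yes; no; does)
  open import Data.Product using (_,_)
  open import Data.Vec as Vec using (Vec; []; _∷_; lookup; tabulate; map; replicate; transpose; _⊛_)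
  import Data.Vec.Properties as Vec
  import Data.Vec.Relation.Unary.All.Properties as All
  open import Relation.Binary.PropositionalEquality
  open import Relation.Binary.Definitions using (tri<; tri≈; tri>)
  open import Relation.Nullary using (contradiction)
  open ≡-Reasoning

  module _ {a} {A : Set a} where

    column : ∀ {m n} → Fin n → Vec (Vec A n) m → Vec A m
    column j = map (λ row → lookup row j)

    lookup-transpose : ∀ {m n} (M : Vec (Vec A n) m) j → lookup (transpose M) j ≡ column j M
    lookup-transpose {n = n} []      j = Vec.lookup-replicate j []
    lookup-transpose {n = n} (r ∷ M) j = begin
      lookup (replicate n _∷_ ⊛ r ⊛ transpose M) j
        ≡⟨ Vec.lookup-⊛ j (replicate n _∷_ ⊛ r) (transpose M) ⟩
      lookup (replicate n _∷_ ⊛ r) j (lookup (transpose M) j)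
        ≡⟨ cong (λ f → f (lookup (transpose M) j)) (Vec.lookup-⊛ j (replicate n _∷_) r) ⟩
      lookup (replicate n _∷_) j (lookup r j) (lookup (transpose M) j)
        ≡⟨ cong (λ f → f (lookup r j) (lookup (transpose M) j)) (Vec.lookup-replicate j _∷_) ⟩
      lookup r j ∷ lookup (transpose M) j
        ≡⟨ cong (lookup r j ∷_) (lookup-transpose M j) ⟩
      column j (r ∷ M)
        ∎

    fromColumns : ∀ {m n} → (Fin n → Vec A m) → Vec (Vec A n) m
    fromColumns c = tabulate (λ i → tabulate (λ j → lookup (c j) i))

    fromColumns-column : ∀ {m n} {c : Fin n → Vec A m} {M : Vec (Vec A n) m} →
                         (∀ j → c j ≡ column j M) → fromColumns c ≡ M
    fromColumns-column {c = c} {M} c≡ = begin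
      tabulate (λ i → tabulate (λ j → lookup (c j) i))
        ≡⟨ Vec.tabulate-cong (λ i → Vec.tabulate-cong (λ j → entry i j)) ⟩
      tabulate (λ i → tabulate (lookup (lookup M i)))
        ≡⟨ Vec.tabulate-cong (λ i → Vec.tabulate∘lookup (lookup M i)) ⟩
      tabulate (lookup M)
        ≡⟨ Vec.tabulate∘lookup M ⟩
      M ∎
      where
      entry : ∀ i j → lookup (c j) i ≡ lookup (lookup M i) j
      entry i j = trans (cong (λ v → lookup v i) (c≡ j)) (Vec.lookup-map i (λ row → lookup row j) M)

  identity-diagonal : ∀ {n} (i : Fin n) → lookup (lookup (identity n) i) i ≡ 1ℚ
  identity-diagonal {n} i = begin
    lookup (lookup (identity n) i) i                             ≡⟨ cong (λ r → lookup r i) (Vec.lookup∘tabulate _ i) ⟩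
    lookup (tabulate (λ j → if does (i ≟ j) then 1ℚ else 0ℚ)) i  ≡⟨ Vec.lookup∘tabulate _ i ⟩
    (if does (i ≟ i) then 1ℚ else 0ℚ)                            ≡⟨ diagonal (i ≟ i) ⟩
    1ℚ                                                           ∎
    where
    diagonal : (d : Dec (i ≡ i)) → (if does d then 1ℚ else 0ℚ) ≡ 1ℚ
    diagonal (yes _)   = refl
    diagonal (no i≢i) = contradiction refl i≢i

  orthogonal⇒column-unit : ∀ {n} (Q : Matrix n) → Orthogonal Q → ∀ j → dot (column j Q) (column j Q) ≡ 1ℚ
  orthogonal⇒column-unit {n} Q QᵀQ≡I j = begin
    dot (column j Q) (column j Q)     ≡⟨ cong₂ dot (lookup-transpose Q j) (lookup-transpose Q j) ⟨
    dot (lookup Qᵀ j) (lookup Qᵀ j)   ≡⟨ Vec.lookup-map j (dot (lookup Qᵀ j)) Qᵀ ⟨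
    lookup (map (dot (lookup Qᵀ j)) Qᵀ) j
      ≡⟨ cong (λ r → lookup r j) (Vec.lookup-map j (λ r → map (dot r) Qᵀ) Qᵀ) ⟨
    lookup (lookup (Qᵀ ⊗ Q) j) j      ≡⟨ cong (λ M → lookup (lookup M j) j) QᵀQ≡I ⟩
    lookup (lookup (identity n) j) j  ≡⟨ identity-diagonal j ⟩
    1ℚ                                ∎
    where Qᵀ = transpose Q

  blockDiag-topLeft : ∀ {s t} (Q : Matrix s) (P : Matrix t) i j →
                      lookup (lookup (blockDiag Q P) (i ↑ˡ t)) (j ↑ˡ t) ≡ lookup (lookup Q i) j
  blockDiag-topLeft {s} {t} Q P i j = begin
    lookup (lookup (blockDiag Q P) (i ↑ˡ t)) (j ↑ˡ t)
      ≡⟨ cong (λ r → lookup r (j ↑ˡ t))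
              (Vec.lookup-++ˡ (map (Vec._++ replicate t 0ℚ) Q) (map (replicate s 0ℚ Vec.++_) P) i) ⟩
    lookup (lookup (map (Vec._++ replicate t 0ℚ) Q) i) (j ↑ˡ t)
      ≡⟨ cong (λ r → lookup r (j ↑ˡ t)) (Vec.lookup-map i (Vec._++ replicate t 0ℚ) Q) ⟩
    lookup (lookup Q i Vec.++ replicate t 0ℚ) (j ↑ˡ t)
      ≡⟨ Vec.lookup-++ˡ (lookup Q i) (replicate t 0ℚ) j ⟩
    lookup (lookup Q i) j
      ∎

  lookup-scale : ∀ {n} {P : ℚ → Set} k (M : Matrix n) → AllEntries P (scale k M) →
                 ∀ i j → P ((+ k / 1) * lookup (lookup M i) j)
  lookup-scale k M PkM i j = All.lookup⁺ (All.map⁻ (All.lookup⁺ (All.map⁻ PkM) i)) j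

  level-unique : ∀ {n a b} {M : Matrix n} → HasLevel a M → HasLevel b M → a ≡ b
  level-unique {a = a} {b} (1≤a , aM∈ℤ , a-least) (1≤b , bM∈ℤ , b-least) with ℕ.<-cmp a b
  ... | tri< a<b _ _ = contradiction aM∈ℤ (b-least a 1≤a a<b)
  ... | tri≈ _ a≡b _ = a≡b
  ... | tri> _ _ b<a = contradiction bM∈ℤ (a-least b 1≤b b<a)

module ColumnCodes (ℓ : ℕ) .{{_ : NonZero ℓ}} where

  import Data.Nat as ℕ
  open import Data.Nat.Properties using (^-*-assoc)
  open import Data.Nat.Divisibility using (_∣_)
  open import Data.Integer as ℤ using (ℤ; +_)
  import Data.Integer.Properties as ℤ
  open import Data.Rational using (ℚ; 1ℚ; _*_; _/_; ↥_; 1/_)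
  import Data.Rational.Properties as ℚ
  open import Data.Fin using (Fin; _↑ˡ_)
  open import Data.Product using (∃-syntax; _,_; proj₁; proj₂; map₂)
  open import Data.List using (List; length)
  open import Data.List.Membership.Propositional using (_∈_)
  open import Data.Vec as Vec using (Vec; lookup; map; tabulate; toList; fromList; cast)
  import Data.Vec.Properties as Vec
  import Data.Vec.Relation.Unary.All as All
  import Data.Vec.Relation.Unary.All.Properties as All
  open import Function using (_∘_)
  open import Relation.Binary.PropositionalEquality
  open ≡-Reasoning
  open Enumeration using (allVecs; length-allVecs; ∈-allVecs)
  open Words using (Letter; letters; length-letters; ∈-letters; net; normSq; wordVec; net-wordVec; length-wordVec)
  open IntegerRationals
  open Matrices

  ℓℚ : ℚ
  ℓℚ = fromℤ (+ ℓ)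

  ℓ⁻¹-cancel : ∀ x → 1/ ℓℚ * (ℓℚ * x) ≡ x
  ℓ⁻¹-cancel x = begin
    1/ ℓℚ * (ℓℚ * x)  ≡⟨ ℚ.*-assoc (1/ ℓℚ) ℓℚ x ⟨
    1/ ℓℚ * ℓℚ * x    ≡⟨ cong (_* x) (ℚ.*-inverseˡ ℓℚ) ⟩
    1ℚ * x            ≡⟨ ℚ.*-identityˡ x ⟩
    x                 ∎

  columnOf : ∀ {s} → List (Letter s) → Vec ℚ s
  columnOf w = tabulate (λ j → 1/ ℓℚ * fromℤ (net w j))

  Code : ℕ → Set
  Code s = Vec (Vec (Letter s) (ℓ ℕ.* ℓ)) s

  decodeQ : ∀ {s} → Code s → Matrix s
  decodeQ W = fromColumns (λ j → columnOf (toList (lookup W j)))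

  allCodes : (s : ℕ) → List (Code s)
  allCodes s = allVecs (allVecs (letters s) (ℓ ℕ.* ℓ)) s

  length-allCodes : ∀ s → length (allCodes s) ≡ (2 ℕ.* s) ℕ.^ (ℓ ℕ.* ℓ ℕ.* s)
  length-allCodes s = begin
    length (allVecs (allVecs (letters s) (ℓ ℕ.* ℓ)) s)
      ≡⟨ length-allVecs (allVecs (letters s) (ℓ ℕ.* ℓ)) s ⟩
    length (allVecs (letters s) (ℓ ℕ.* ℓ)) ℕ.^ s
      ≡⟨ cong (ℕ._^ s) (length-allVecs (letters s) (ℓ ℕ.* ℓ)) ⟩
    (length (letters s) ℕ.^ (ℓ ℕ.* ℓ)) ℕ.^ s
      ≡⟨ cong (λ m → (m ℕ.^ (ℓ ℕ.* ℓ)) ℕ.^ s) (length-letters s) ⟩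
    ((2 ℕ.* s) ℕ.^ (ℓ ℕ.* ℓ)) ℕ.^ s
      ≡⟨ ^-*-assoc (2 ℕ.* s) (ℓ ℕ.* ℓ) s ⟩
    (2 ℕ.* s) ℕ.^ (ℓ ℕ.* ℓ ℕ.* s)
      ∎

  ∈-allCodes : ∀ {s} (W : Code s) → W ∈ allCodes s
  ∈-allCodes = ∈-allVecs (∈-allVecs ∈-letters)

  module _ {s} (c : Vec ℚ s) (ℓc∈ℤ : All.All IsInt (map (ℓℚ *_) c)) where

    numerators : Vec ℤ s
    numerators = map ↥_ (map (ℓℚ *_) c)

    normSq-numerators : dot c c ≡ 1ℚ → normSq numerators ≡ ℓ ℕ.* ℓ
    normSq-numerators c·c≡1 = ℤ.+-injective (fromℤ-injective (begin
      fromℤ (+ normSq numerators)                        ≡⟨ fromℤ-normSq numerators ⟩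
      dot (map fromℤ numerators) (map fromℤ numerators)  ≡⟨ cong₂ dot (map-fromℤ-↥ ℓc∈ℤ) (map-fromℤ-↥ ℓc∈ℤ) ⟩
      dot (map (ℓℚ *_) c) (map (ℓℚ *_) c)                ≡⟨ dot-scale ℓℚ c c ⟩
      ℓℚ * ℓℚ * dot c c                                  ≡⟨ cong (ℓℚ * ℓℚ *_) c·c≡1 ⟩
      ℓℚ * ℓℚ * 1ℚ                                       ≡⟨ ℚ.*-identityʳ (ℓℚ * ℓℚ) ⟩
      ℓℚ * ℓℚ                                            ≡⟨ fromℤ-* (+ ℓ) (+ ℓ) ⟨
      fromℤ (+ ℓ ℤ.* + ℓ)                                ≡⟨ cong fromℤ (ℤ.pos-* ℓ ℓ) ⟨
      fromℤ (+ (ℓ ℕ.* ℓ))                                ∎))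

    columnOf-wordVec : columnOf (wordVec numerators) ≡ c
    columnOf-wordVec = begin
      tabulate (λ j → 1/ ℓℚ * fromℤ (net (wordVec numerators) j))
        ≡⟨ Vec.tabulate-cong (λ j → cong (λ z → 1/ ℓℚ * fromℤ z) (net-wordVec numerators j)) ⟩
      tabulate (λ j → 1/ ℓℚ * fromℤ (lookup numerators j))
        ≡⟨ Vec.tabulate-cong (λ j → cong (1/ ℓℚ *_) (fromℤ-numerator j)) ⟩
      tabulate (λ j → 1/ ℓℚ * (ℓℚ * lookup c j))
        ≡⟨ Vec.tabulate-cong (λ j → ℓ⁻¹-cancel (lookup c j)) ⟩
      tabulate (lookup c)
        ≡⟨ Vec.tabulate∘lookup c ⟩
      c ∎
      where
      fromℤ-numerator : ∀ j → fromℤ (lookup numerators j) ≡ ℓℚ * lookup c j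
      fromℤ-numerator j = begin
        fromℤ (lookup numerators j)      ≡⟨ Vec.lookup-map j fromℤ numerators ⟨
        lookup (map fromℤ numerators) j  ≡⟨ cong (λ v → lookup v j) (map-fromℤ-↥ ℓc∈ℤ) ⟩
        lookup (map (ℓℚ *_) c) j         ≡⟨ Vec.lookup-map j (ℓℚ *_) c ⟩
        ℓℚ * lookup c j                  ∎

    encodeColumn : dot c c ≡ 1ℚ → ∃[ w ] columnOf (toList w) ≡ c
    encodeColumn c·c≡1 = cast length≡ℓ² (fromList word) , (begin
      columnOf (toList (cast length≡ℓ² (fromList word)))  ≡⟨ cong columnOf (Vec.toList-cast length≡ℓ² (fromList word)) ⟩
      columnOf (toList (fromList word))                   ≡⟨ cong columnOf (Vec.toList∘fromList word) ⟩
      columnOf word                                       ≡⟨ columnOf-wordVec ⟩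
      c                                                   ∎)
      where
      word = wordVec numerators
      length≡ℓ² : length word ≡ ℓ ℕ.* ℓ
      length≡ℓ² = trans (length-wordVec numerators) (normSq-numerators c·c≡1)

  encodeMatrix : ∀ {s} (Q : Matrix s) → Orthogonal Q → (∀ i j → IsInt (ℓℚ * lookup (lookup Q i) j)) →
                 ∃[ W ] decodeQ W ≡ Q
  encodeMatrix {s} Q orth ℓQ∈ℤ = tabulate code , fromColumns-column decodes
    where
    ℓcolumn∈ℤ : ∀ j → All.All IsInt (map (ℓℚ *_) (column j Q))
    ℓcolumn∈ℤ j = All.lookup⁻ λ i → subst IsInt (sym (begin
      lookup (map (ℓℚ *_) (column j Q)) i  ≡⟨ Vec.lookup-map i (ℓℚ *_) (column j Q) ⟩
      ℓℚ * lookup (column j Q) i           ≡⟨ cong (ℓℚ *_) (Vec.lookup-map i (λ row → lookup row j) Q) ⟩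
      ℓℚ * lookup (lookup Q i) j           ∎)) (ℓQ∈ℤ i j)

    encoded : ∀ j → ∃[ w ] columnOf (toList w) ≡ column j Q
    encoded j = encodeColumn (column j Q) (ℓcolumn∈ℤ j) (orthogonal⇒column-unit Q orth j)

    code : Fin s → Vec (Letter s) (ℓ ℕ.* ℓ)
    code j = proj₁ (encoded j)

    decodes : ∀ j → columnOf (toList (lookup (tabulate code) j)) ≡ column j Q
    decodes j = trans (cong (columnOf ∘ toList) (Vec.lookup∘tabulate code j)) (proj₂ (encoded j))

  CAN⇒decodable : ∀ {s t d M} → d ∣ ℓ → CAN s t d M → ∃[ W ] blockDiag (decodeQ W) (identity t) ≡ M
  CAN⇒decodable {s} {t} {d} d∣ℓ ((_ , _ , dM∈ℤ , _) , Q , orth , _ , refl) =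
    map₂ (cong (λ Q → blockDiag Q (identity t))) (encodeMatrix Q orth ℓQ∈ℤ)
    where
    ℓQ∈ℤ : ∀ i j → IsInt (ℓℚ * lookup (lookup Q i) j)
    ℓQ∈ℤ i j = divides⇒isInt _ d∣ℓ
      (subst (λ x → IsInt ((+ d / 1) * x)) (blockDiag-topLeft Q (identity t) i j)
             (lookup-scale d (blockDiag Q (identity t)) dM∈ℤ (i ↑ˡ t) (j ↑ˡ t)))

open import Data.Nat using (ℕ; _≤_; _+_; _*_; _^_)
open import Data.Nat.Divisibility using (_∣_)
open import Data.List using (List; length)
open import Data.List.Relation.Unary.All using (All)
open import Data.List.Relation.Unary.Unique.Propositional using (Unique)
open import Data.Product using (_×_)
open import Data.Nat as ℕ using (zero; suc)
import Data.Nat.Properties as ℕ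
open import Data.Nat.Divisibility using (_∣?_)
open import Data.Product using (_,_; proj₁; proj₂)
open import Data.List as List using (concatMap; upTo)
open import Data.List.Properties using (length-map)
open import Data.List.Membership.Propositional using (_∈_)
open import Data.List.Membership.Propositional.Properties using (∈-filter⁻; ∈-map⁺)
import Data.List.Relation.Unary.All as All
import Data.List.Relation.Unary.All.Properties as All
import Data.List.Relation.Unary.Unique.Propositional.Properties as Unique
open import Function using (_∘_)
open import Relation.Binary.PropositionalEquality using (subst)
open Enumeration using (Unique-⊆⇒length≤; length-concatMap; Unique-concatMap)
open Matrices using (level-unique)

∈-divisors⇒∣ : ∀ {d ℓ} → d ∈ divisors ℓ → d ∣ ℓ
∈-divisors⇒∣ {ℓ = ℓ} d∈ = proj₂ (∈-filter⁻ (_∣? ℓ) {xs = List.map suc (upTo ℓ)} d∈)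

divisors-unique : ∀ ℓ → Unique (divisors ℓ)
divisors-unique ℓ = Unique.filter⁺ (_∣? ℓ) (Unique.map⁺ ℕ.suc-injective (Unique.upTo⁺ ℓ))

mainTheorem3 : (s t ℓ : ℕ) → 1 ≤ s → 1 ≤ ℓ →
    (L : ℕ → List (Matrix (s + t))) →
    (∀ ℓ' → ℓ' ∣ ℓ → Unique (L ℓ') × All (CAN s t ℓ') (L ℓ')) →
    sumDiv ℓ (λ ℓ' → length (L ℓ')) ≤ (2 * s) ^ (ℓ * ℓ * s)
mainTheorem3 s t zero        _ () L H
mainTheorem3 s t ℓ@(suc _) _ _  L H = begin
  sumDiv ℓ (λ ℓ' → length (L ℓ'))        ≡⟨ length-concatMap L (divisors ℓ) ⟨
  length (concatMap L (divisors ℓ))      ≤⟨ Unique-⊆⇒length≤ unique decodable ⟩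
  length (List.map decode (allCodes s))  ≡⟨ length-map decode (allCodes s) ⟩
  length (allCodes s)                    ≡⟨ length-allCodes s ⟩
  (2 * s) ^ (ℓ * ℓ * s)                  ∎
  where
  open ℕ.≤-Reasoning
  open ColumnCodes ℓ

  decode : Code s → Matrix (s + t)
  decode W = blockDiag (decodeQ W) (identity t)

  unique : Unique (concatMap L (divisors ℓ))
  unique = Unique-concatMap L HasLevel level-unique (divisors-unique ℓ) (All.tabulate λ d∈ →
    let (uniq , cans) = H _ (∈-divisors⇒∣ d∈) in uniq , All.map (proj₂ ∘ proj₁) cans)

  decodable : All (_∈ List.map decode (allCodes s)) (concatMap L (divisors ℓ))
  decodable = All.concat⁺ (All.map⁺ (All.tabulate λ d∈ → All.map
    (λ can → let (W , W↦M) = CAN⇒decodable (∈-divisors⇒∣ d∈) can in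
             subst (_∈ _) W↦M (∈-map⁺ decode (∈-allCodes W)))
    (proj₂ (H _ (∈-divisors⇒∣ d∈)))))
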